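{- Let $n\ge k\ge2$ be powers of $2$ with $k=2^h$, and let $i_1<i_2<\dots<i_h$ be elements of $[\log_2 n]$. Let $(x_1, \ldots, x_k)$ be a $k$-tuple of elements of $\{0,1,\dots,n-1\}$ with $x_1 < \ldots < x_k$, and let $f = f_{i_1, \ldots, i_{h}}$. Then $f(x_1) < f(x_2) < \ldots < f(x_k)$ if and only if $(x_1, \ldots, x_k)$ has binary $h$-profile of type $(i_1, \ldots, i_{h})$. Furthermore, $f_{i_1, \ldots, i_{h}}$ has no increasing subsequence of length $k+1$ or more (i.e., no $y_1<\dots<y_{k+1}$ with $f(y_1)<\dots<f(y_{k+1})$).
   Context: Every nonnegative integer $t$ has a binary representation $(b^t_1,b^t_2,\dots)$ with $t=\sum_j b^t_j 2^{j-1}$; for distinct $x,y$, $M(x,y)$ is the largest index $i$ with $b^x_i\ne b^y_i$. For $i\in[\log_2 n]$, $F_i\colon\{0,\dots,n-1\}\to\{0,\dots,n-1\}$ flips the $i$-th bit of the binary representation. Let $f^{\downarrow}(x)=n+1-x$ and $f_{i_1,\dots,i_h}=f^{\downarrow}\circ F_{i_h}\circ\dots\circ F_{i_1}$. A tuple $(x_1,\dots,x_k)$ with $x_1<\dots<x_k$ has binary $h$-profile of type $(i_1,\dots,i_h)$ (where $i_1<\dots<i_h$) if $M(x_j,x_{j+1})=i_{M(j-1,j)}$ for every $j\in[k-1]$, with $M(j-1,j)\in[h]$ computed on the integers $j-1,j$. -}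

module Defs where

open import Data.Nat using (ℕ; zero; suc; _+_; _∸_; _^_; _/_; _%_; _<_; _≤_)
open import Data.Fin using (Fin; toℕ)
open import Data.List using (List; []; _∷_; tabulate)
open import Data.Product using (Σ; _×_; ∃)
open import Relation.Binary.PropositionalEquality using (_≡_; _≢_)
open import Relation.Nullary using (¬_)
open import Data.Bool using (if_then_else_)
open import Relation.Nullary.Decidable using (⌊_⌋)
open import Data.Nat using (_≟_)
open import Data.Nat.Properties using (m^n≢0)

-- b^t_i : the i-th binary digit of t (1-indexed; meaningful for i ≥ 1),
-- so that t = Σ_j b^t_j 2^(j-1).
bit : ℕ → ℕ → ℕ
bit i t = (_/_ t (2 ^ (i ∸ 1)) {{m^n≢0 2 (i ∸ 1)}}) % 2

IsM : ℕ → ℕ → ℕ → Set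
IsM x y i = (1 ≤ i) × (bit i x ≢ bit i y) × (∀ j → i < j → bit j x ≡ bit j y)

F : ℕ → ℕ → ℕ
F i x = if ⌊ bit i x ≟ 0 ⌋ then x + 2 ^ (i ∸ 1) else x ∸ 2 ^ (i ∸ 1)

applyFlips : List ℕ → ℕ → ℕ
applyFlips [] x = x
applyFlips (i ∷ is) x = applyFlips is (F i x)

fdown : ℕ → ℕ → ℕ
fdown n x = (n + 1) ∸ x

fIdx : (n h : ℕ) → (Fin h → ℕ) → ℕ → ℕ
fIdx n h i x = fdown n (applyFlips (tabulate i) x)

Increasing : {k : ℕ} → (Fin k → ℕ) → Set
Increasing {k} x = ∀ (a b : Fin k) → toℕ b ≡ suc (toℕ a) → x a < x b

-- Positions are 0-indexed Fin: a ↔ x_j, b ↔ x_{j+1}, j = toℕ b, j-1 = toℕ a;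
-- i r ↔ i_{toℕ r + 1}.
HasProfile : {k h : ℕ} → (Fin h → ℕ) → (Fin k → ℕ) → Set
HasProfile {k} {h} i x =
  ∀ (a b : Fin k) → toℕ b ≡ suc (toℕ a) →
    Σ (Fin h) λ r → IsM (toℕ a) (toℕ b) (suc (toℕ r)) × IsM (x a) (x b) (i r)

module Submission where

-- Write G = F_{i_h} ∘ … ∘ F_{i_1}, so that f = f↓ ∘ G and, on values below n,
-- f u < f v exactly when G v < G u.  The proof rests on three facts.
--  (1) Order is decided by the top differing digit: if M(u,v) = p, then u < v
--      iff b^u_p = 0 and b^v_p = 1.
--  (2) G flips the digits at i_1,…,i_h and keeps all others, so for u < v it
--      reverses the order of u and v iff M(u,v) is one of the i_r.  Hence f is
--      increasing along x_1 < … < x_k iff every M(x_j, x_{j+1}) is some i_r.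
--  (3) The compression c(u) = Σ_r b^u_{i_r} 2^{r-1} < 2^h sends u < v with
--      M(u,v) = i_r to c(u) < c(v) with M(c(u), c(v)) = r.
-- If f is increasing along x, then c ∘ x is a strictly increasing sequence of
-- length 2^h with values below 2^h, so c(x_j) = j - 1 and (3) turns
-- M(x_j, x_{j+1}) = i_r into M(j-1, j) = r: this is the profile; the converse is
-- (2).  An increasing subsequence of f of length 2^h + 1 would similarly give
-- 2^h + 1 strictly increasing values below 2^h, which is impossible.

open import Defs
open import Data.Nat
open import Data.Nat.Properties
open import Data.Nat.DivMod
open import Data.Nat.Divisibility using (divides-refl)
open import Data.Nat.Induction using (<-rec)
open import Data.Nat.Tactic.RingSolver using (solve-∀)
open import Data.Empty using (⊥-elim)
open import Data.Product
open import Data.Sum using (_⊎_; inj₁; inj₂)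
open import Data.Fin using (Fin; toℕ; fromℕ; fromℕ<) renaming (zero to fz; suc to fs)
open import Data.Fin.Properties using (toℕ<n; toℕ-fromℕ; toℕ-fromℕ<; toℕ-injective)
open import Data.List using (List; []; _∷_; tabulate)
open import Data.List.Relation.Unary.All as All using (All; []; _∷_)
open import Data.List.Relation.Unary.All.Properties using (tabulate⁺)
open import Data.List.Relation.Unary.AllPairs as AllPairs using (AllPairs; []; _∷_)
open import Data.List.Relation.Unary.AllPairs.Properties using (tabulate⁺-<)
open import Data.List.Relation.Unary.Any using (here; there)
open import Data.List.Membership.Propositional using (_∈_; _∉_)
open import Data.List.Membership.Propositional.Properties using (∈-tabulate⁺; ∈-tabulate⁻)
open import Data.List.Membership.DecPropositional _≟_ using (_∈?_)
open import Function using (_∘_)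
open import Function.Bundles using (_⇔_; mk⇔)
open import Relation.Binary.PropositionalEquality
open import Relation.Nullary using (¬_; Dec; yes; no)

bit<2 : ∀ j t → bit j t < 2
bit<2 j t = m%n<n ((t / 2 ^ (j ∸ 1)) {{m^n≢0 2 (j ∸ 1)}}) 2

complement<2 : ∀ b → 1 ∸ b < 2
complement<2 b = ≤-<-trans (m∸n≤m 1 b) (s≤s (s≤s z≤n))

digit-cases : ∀ b → b < 2 → b ≡ 0 ⊎ b ≡ 1
digit-cases zero _ = inj₁ refl
digit-cases (suc zero) _ = inj₂ refl
digit-cases (suc (suc b)) (s≤s (s≤s ()))

bit-one : ∀ t → bit 1 t ≡ t % 2
bit-one t = cong (_% 2) (n/1≡n t)

bit-half : ∀ j t → bit (suc (suc j)) t ≡ bit (suc j) (t / 2)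
bit-half j t = cong (_% 2)
  (sym (m/n/o≡m/[n*o] t 2 (2 ^ j) {{_}} {{m^n≢0 2 j}} {{m^n≢0 2 (suc j)}}))

bit-zero : ∀ j → bit j 0 ≡ 0
bit-zero j = cong (_% 2) (0/n≡0 (2 ^ (j ∸ 1)) {{m^n≢0 2 (j ∸ 1)}})

split-parity : ∀ t → t ≡ t % 2 + t / 2 * 2
split-parity t = m≡m%n+[m/n]*n t 2

append-induction : (P : ℕ → Set) → (∀ b q → b < 2 → P (b + q * 2)) → ∀ t → P t
append-induction P step t = subst P (sym (split-parity t)) (step (t % 2) (t / 2) (m%n<n t 2))

bit-one-append : ∀ b q → b < 2 → bit 1 (b + q * 2) ≡ b
bit-one-append b q b<2 = trans (bit-one (b + q * 2)) (trans ([m+kn]%n≡m%n b q 2) (m<n⇒m%n≡m b<2))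

bit-suc-append : ∀ j b q → b < 2 → bit (suc (suc j)) (b + q * 2) ≡ bit (suc j) q
bit-suc-append j b q b<2 = trans (bit-half j _) (cong (bit (suc j)) half-of-append)
  where
  half-of-append : (b + q * 2) / 2 ≡ q
  half-of-append =
    trans (+-distrib-/-∣ʳ b (divides-refl q)) (cong₂ _+_ (m<n⇒m/n≡0 b<2) (m*n/n≡m q 2))

digits-zero : ∀ t → (∀ j → bit (suc j) t ≡ 0) → t ≡ 0
digits-zero = <-rec (λ t → (∀ j → bit (suc j) t ≡ 0) → t ≡ 0) step
  where
  step : ∀ t → (∀ {s} → s < t → (∀ j → bit (suc j) s ≡ 0) → s ≡ 0) →
         (∀ j → bit (suc j) t ≡ 0) → t ≡ 0
  step zero _ _ = refl
  step t@(suc _) rec zeros = trans (split-parity t) (cong₂ (λ b q → b + q * 2) low-digit half)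
    where
    low-digit : t % 2 ≡ 0
    low-digit = trans (sym (bit-one t)) (zeros 0)
    half : t / 2 ≡ 0
    half = rec (m/n<m t 2 (s≤s (s≤s z≤n))) (λ j → trans (sym (bit-half j t)) (zeros (suc j)))

digits-injective : ∀ u v → (∀ j → bit (suc j) u ≡ bit (suc j) v) → u ≡ v
digits-injective = <-rec (λ u → ∀ v → (∀ j → bit (suc j) u ≡ bit (suc j) v) → u ≡ v) step
  where
  step : ∀ u → (∀ {s} → s < u → ∀ v → (∀ j → bit (suc j) s ≡ bit (suc j) v) → s ≡ v) →
         ∀ v → (∀ j → bit (suc j) u ≡ bit (suc j) v) → u ≡ v
  step zero _ v same = sym (digits-zero v (λ j → trans (sym (same j)) (bit-zero (suc j))))
  step u@(suc _) rec v same =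
    trans (split-parity u) (trans (cong₂ (λ b q → b + q * 2) low-digit half) (sym (split-parity v)))
    where
    low-digit : u % 2 ≡ v % 2
    low-digit = trans (sym (bit-one u)) (trans (same 0) (bit-one v))
    half : u / 2 ≡ v / 2
    half = rec (m/n<m u 2 (s≤s (s≤s z≤n))) (v / 2)
      (λ j → trans (sym (bit-half j u)) (trans (same (suc j)) (bit-half j v)))

half-bound : ∀ m t → t < 2 ^ suc m → t / 2 < 2 ^ m
half-bound m t t< = m<n*o⇒m/o<n {n = 2 ^ m} {o = 2} (subst (t <_) (*-comm 2 (2 ^ m)) t<)

append-bound : ∀ b q P → b < 2 → q < P → b + q * 2 < 2 * P
append-bound b q P b<2 q<P = begin-strict
    b + q * 2  <⟨ +-monoˡ-< (q * 2) b<2 ⟩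
    suc q * 2  ≤⟨ *-monoˡ-≤ 2 q<P ⟩
    P * 2      ≡⟨ *-comm P 2 ⟩
    2 * P      ∎
  where open ≤-Reasoning

bounded⇒high-zero : ∀ m t → t < 2 ^ m → ∀ j → m < j → bit j t ≡ 0
bounded⇒high-zero zero zero _ j _ = bit-zero j
bounded⇒high-zero zero (suc t) (s≤s ()) _ _
bounded⇒high-zero (suc m) t t< (suc (suc j)) (s≤s m<j) =
  trans (bit-half j t) (bounded⇒high-zero m (t / 2) (half-bound m t t<) (suc j) m<j)

high-zero⇒bounded : ∀ m t → (∀ j → m < j → bit j t ≡ 0) → t < 2 ^ m
high-zero⇒bounded zero t zeros =
  subst (_< 1) (sym (digits-zero t (λ j → zeros (suc j) (s≤s z≤n)))) (s≤s z≤n)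
high-zero⇒bounded (suc m) t zeros =
  subst (_< 2 ^ suc m) (sym (split-parity t))
    (append-bound (t % 2) (t / 2) (2 ^ m) (m%n<n t 2) (high-zero⇒bounded m (t / 2) half-zeros))
  where
  half-zeros : ∀ j → m < j → bit j (t / 2) ≡ 0
  half-zeros (suc j) (s≤s m<j) = trans (sym (bit-half j t)) (zeros (suc (suc j)) (s≤s (s≤s m<j)))

AgreeAbove : ℕ → ℕ → ℕ → Set
AgreeAbove u v p = ∀ j → p < j → bit j u ≡ bit j v

agree-half : ∀ {u v p} → AgreeAbove u v (suc (suc p)) → AgreeAbove (u / 2) (v / 2) (suc p)
agree-half {u} {v} agree (suc j) (s≤s p<j) =
  trans (sym (bit-half j u)) (trans (agree (suc (suc j)) (s≤s (s≤s p<j))) (bit-half j v))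

agree-double : ∀ {u v p} → AgreeAbove (u / 2) (v / 2) (suc p) → AgreeAbove u v (suc (suc p))
agree-double {u} {v} agree (suc (suc j)) (s≤s p<j) =
  trans (bit-half j u) (trans (agree (suc j) p<j) (sym (bit-half j v)))

IsM-exists : ∀ N u v → u < 2 ^ N → v < 2 ^ N → u ≢ v → Σ ℕ (IsM u v)
IsM-exists zero zero zero _ _ u≢v = ⊥-elim (u≢v refl)
IsM-exists zero (suc u) v (s≤s ()) _ _
IsM-exists zero zero (suc v) _ (s≤s ()) _
IsM-exists (suc N) u v u< v< u≢v with u / 2 ≟ v / 2
... | yes same-half = 1 , s≤s z≤n , parities-differ , agree
  where
  parities-differ : bit 1 u ≢ bit 1 v
  parities-differ same = u≢v (trans (split-parity u) (trans
    (cong₂ (λ b q → b + q * 2) (trans (sym (bit-one u)) (trans same (bit-one v))) same-half)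
    (sym (split-parity v))))
  agree : AgreeAbove u v 1
  agree (suc zero) (s≤s ())
  agree (suc (suc j)) _ = trans (bit-half j u) (trans (cong (bit (suc j)) same-half) (sym (bit-half j v)))
... | no halves-differ
  with IsM-exists N (u / 2) (v / 2) (half-bound N u u<) (half-bound N v v<) halves-differ
...   | suc p , _ , differ , agree =
  suc (suc p) , s≤s z≤n ,
  (λ same → differ (trans (sym (bit-half p u)) (trans same (bit-half p v)))) ,
  agree-double agree

top-digit-order : ∀ p u v → bit (suc p) u ≡ 0 → bit (suc p) v ≡ 1 →
                  AgreeAbove u v (suc p) → u < v
top-digit-order zero u v u0 v1 agree = ≤-reflexive (begin
    suc u                       ≡⟨ cong suc (split-parity u) ⟩
    suc (u % 2 + u / 2 * 2)     ≡⟨ cong₂ (λ b q → suc (b + q * 2)) (trans (sym (bit-one u)) u0) same-half ⟩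
    suc (v / 2 * 2)             ≡⟨ cong (_+ v / 2 * 2) (trans (sym v1) (bit-one v)) ⟩
    v % 2 + v / 2 * 2           ≡⟨ sym (split-parity v) ⟩
    v                           ∎)
  where
  open ≡-Reasoning
  same-half : u / 2 ≡ v / 2
  same-half = digits-injective (u / 2) (v / 2)
    (λ j → trans (sym (bit-half j u)) (trans (agree (suc (suc j)) (s≤s (s≤s z≤n))) (bit-half j v)))
top-digit-order (suc p) u v u0 v1 agree = ≰⇒> (λ v≤u → <⇒≱ halves-ordered (/-monoˡ-≤ 2 v≤u))
  where
  halves-ordered : u / 2 < v / 2
  halves-ordered = top-digit-order p (u / 2) (v / 2)
    (trans (sym (bit-half p u)) u0) (trans (sym (bit-half p v)) v1) (agree-half agree)

order⇒top-digits : ∀ {u v p} → u < v → IsM u v p → bit p u ≡ 0 × bit p v ≡ 1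
order⇒top-digits {u} {v} {suc p} u<v (_ , differ , agree)
  with digit-cases _ (bit<2 (suc p) u) | digit-cases _ (bit<2 (suc p) v)
... | inj₁ u0 | inj₂ v1 = u0 , v1
... | inj₁ u0 | inj₁ v0 = ⊥-elim (differ (trans u0 (sym v0)))
... | inj₂ u1 | inj₂ v1 = ⊥-elim (differ (trans u1 (sym v1)))
... | inj₂ u1 | inj₁ v0 =
  ⊥-elim (<-asym u<v (top-digit-order p v u v0 u1 (λ j p<j → sym (agree j p<j))))

F-on-0 : ∀ c x → bit c x ≡ 0 → F c x ≡ x + 2 ^ (c ∸ 1)
F-on-0 c x x0 with bit c x ≟ 0
... | yes _ = refl
... | no x≢0 = ⊥-elim (x≢0 x0)

F-on-1 : ∀ c x → bit c x ≢ 0 → F c x ≡ x ∸ 2 ^ (c ∸ 1)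
F-on-1 c x x≢0 with bit c x ≟ 0
... | yes x0 = ⊥-elim (x≢0 x0)
... | no _ = refl

F-one-append : ∀ b q → b < 2 → F 1 (b + q * 2) ≡ (1 ∸ b) + q * 2
F-one-append zero q _ = trans (F-on-0 1 (q * 2) (bit-one-append 0 q (s≤s z≤n))) (+-comm (q * 2) 1)
F-one-append (suc zero) q b<2 = F-on-1 1 (1 + q * 2) (λ one≡0 → 1≢0 (trans (sym (bit-one-append 1 q b<2)) one≡0))
  where
  1≢0 : 1 ≢ 0
  1≢0 ()
F-one-append (suc (suc b)) q (s≤s (s≤s ()))

F-suc-append : ∀ c b q → b < 2 → F (suc (suc c)) (b + q * 2) ≡ b + F (suc c) q * 2
F-suc-append c b q b<2 = by-digit (bit (suc c) q ≟ 0)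
  where
  open ≡-Reasoning
  shift-add : ∀ b q p → b + q * 2 + 2 * p ≡ b + (q + p) * 2
  shift-add = solve-∀
  shift-sub : ∀ b d p → b + (p + d) * 2 ≡ b + d * 2 + 2 * p
  shift-sub = solve-∀
  by-digit : Dec (bit (suc c) q ≡ 0) → F (suc (suc c)) (b + q * 2) ≡ b + F (suc c) q * 2
  by-digit (yes q0) = begin
    F (suc (suc c)) (b + q * 2)  ≡⟨ F-on-0 (suc (suc c)) (b + q * 2) (trans (bit-suc-append c b q b<2) q0) ⟩
    b + q * 2 + 2 * 2 ^ c        ≡⟨ shift-add b q (2 ^ c) ⟩
    b + (q + 2 ^ c) * 2          ≡⟨ cong (λ q′ → b + q′ * 2) (sym (F-on-0 (suc c) q q0)) ⟩
    b + F (suc c) q * 2          ∎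
  by-digit (no q≢0) = begin
    F (suc (suc c)) (b + q * 2)
      ≡⟨ F-on-1 (suc (suc c)) (b + q * 2) (λ e → q≢0 (trans (sym (bit-suc-append c b q b<2)) e)) ⟩
    b + q * 2 ∸ 2 * 2 ^ c
      ≡⟨ cong (λ q′ → b + q′ * 2 ∸ 2 * 2 ^ c) (sym (m+[n∸m]≡n 2^c≤q)) ⟩
    b + (2 ^ c + (q ∸ 2 ^ c)) * 2 ∸ 2 * 2 ^ c
      ≡⟨ cong (_∸ 2 * 2 ^ c) (shift-sub b (q ∸ 2 ^ c) (2 ^ c)) ⟩
    b + (q ∸ 2 ^ c) * 2 + 2 * 2 ^ c ∸ 2 * 2 ^ c
      ≡⟨ m+n∸n≡m (b + (q ∸ 2 ^ c) * 2) (2 * 2 ^ c) ⟩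
    b + (q ∸ 2 ^ c) * 2
      ≡⟨ cong (λ q′ → b + q′ * 2) (sym (F-on-1 (suc c) q q≢0)) ⟩
    b + F (suc c) q * 2          ∎
    where
    2^c≤q : 2 ^ c ≤ q
    2^c≤q = m/n≢0⇒n≤m {{m^n≢0 2 c}} (λ e → q≢0 (cong (_% 2) e))

bit-F-same : ∀ c x → bit (suc c) (F (suc c) x) ≡ 1 ∸ bit (suc c) x
bit-F-same c = append-induction (λ x → bit (suc c) (F (suc c) x) ≡ 1 ∸ bit (suc c) x) (on-append c)
  where
  on-append : ∀ c b q → b < 2 → bit (suc c) (F (suc c) (b + q * 2)) ≡ 1 ∸ bit (suc c) (b + q * 2)
  on-append zero b q b<2 = begin
      bit 1 (F 1 (b + q * 2))  ≡⟨ cong (bit 1) (F-one-append b q b<2) ⟩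
      bit 1 (1 ∸ b + q * 2)    ≡⟨ bit-one-append (1 ∸ b) q (complement<2 b) ⟩
      1 ∸ b                    ≡⟨ cong (1 ∸_) (sym (bit-one-append b q b<2)) ⟩
      1 ∸ bit 1 (b + q * 2)    ∎
    where open ≡-Reasoning
  on-append (suc c) b q b<2 = begin
      bit (suc (suc c)) (F (suc (suc c)) (b + q * 2))  ≡⟨ cong (bit (suc (suc c))) (F-suc-append c b q b<2) ⟩
      bit (suc (suc c)) (b + F (suc c) q * 2)          ≡⟨ bit-suc-append c b (F (suc c) q) b<2 ⟩
      bit (suc c) (F (suc c) q)                        ≡⟨ bit-F-same c q ⟩
      1 ∸ bit (suc c) q                                ≡⟨ cong (1 ∸_) (sym (bit-suc-append c b q b<2)) ⟩
      1 ∸ bit (suc (suc c)) (b + q * 2)                ∎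
    where open ≡-Reasoning

bit-F-other : ∀ c j x → j ≢ c → bit (suc j) (F (suc c) x) ≡ bit (suc j) x
bit-F-other c j x j≢c =
  append-induction (λ x → bit (suc j) (F (suc c) x) ≡ bit (suc j) x) (λ b q b<2 → on-append c j b q b<2 j≢c) x
  where
  on-append : ∀ c j b q → b < 2 → j ≢ c → bit (suc j) (F (suc c) (b + q * 2)) ≡ bit (suc j) (b + q * 2)
  on-append zero zero b q b<2 j≢c = ⊥-elim (j≢c refl)
  on-append (suc c) zero b q b<2 _ = begin
      bit 1 (F (suc (suc c)) (b + q * 2))  ≡⟨ cong (bit 1) (F-suc-append c b q b<2) ⟩
      bit 1 (b + F (suc c) q * 2)          ≡⟨ bit-one-append b (F (suc c) q) b<2 ⟩
      b                                    ≡⟨ sym (bit-one-append b q b<2) ⟩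
      bit 1 (b + q * 2)                    ∎
    where open ≡-Reasoning
  on-append zero (suc j) b q b<2 _ = begin
      bit (suc (suc j)) (F 1 (b + q * 2))  ≡⟨ cong (bit (suc (suc j))) (F-one-append b q b<2) ⟩
      bit (suc (suc j)) (1 ∸ b + q * 2)    ≡⟨ bit-suc-append j (1 ∸ b) q (complement<2 b) ⟩
      bit (suc j) q                        ≡⟨ sym (bit-suc-append j b q b<2) ⟩
      bit (suc (suc j)) (b + q * 2)        ∎
    where open ≡-Reasoning
  on-append (suc c) (suc j) b q b<2 j≢c = begin
      bit (suc (suc j)) (F (suc (suc c)) (b + q * 2))  ≡⟨ cong (bit (suc (suc j))) (F-suc-append c b q b<2) ⟩
      bit (suc (suc j)) (b + F (suc c) q * 2)          ≡⟨ bit-suc-append j b (F (suc c) q) b<2 ⟩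
      bit (suc j) (F (suc c) q)                        ≡⟨ bit-F-other c j q (j≢c ∘ cong suc) ⟩
      bit (suc j) q                                    ≡⟨ sym (bit-suc-append j b q b<2) ⟩
      bit (suc (suc j)) (b + q * 2)                    ∎
    where open ≡-Reasoning

flip-same : ∀ c x → 1 ≤ c → bit c (F c x) ≡ 1 ∸ bit c x
flip-same (suc c) x _ = bit-F-same c x

flip-other : ∀ c j x → 1 ≤ c → 1 ≤ j → j ≢ c → bit j (F c x) ≡ bit j x
flip-other (suc c) (suc j) x _ _ j≢c = bit-F-other c j x (j≢c ∘ cong suc)

flips-outside : ∀ L j x → All (1 ≤_) L → j ∉ L → 1 ≤ j → bit j (applyFlips L x) ≡ bit j x
flips-outside [] j x _ _ _ = refl
flips-outside (c ∷ L) j x (1≤c ∷ positive) j∉ 1≤j =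
  trans (flips-outside L j (F c x) positive (j∉ ∘ there) 1≤j) (flip-other c j x 1≤c 1≤j (j∉ ∘ here))

flips-inside : ∀ L j x → All (1 ≤_) L → AllPairs _≢_ L → j ∈ L → 1 ≤ j →
               bit j (applyFlips L x) ≡ 1 ∸ bit j x
flips-inside (c ∷ L) .c x (1≤c ∷ positive) (c≢L ∷ _) (here refl) 1≤j =
  trans (flips-outside L c (F c x) positive (λ c∈L → All.lookup c≢L c∈L refl) 1≤j) (flip-same c x 1≤c)
flips-inside (c ∷ L) j x (1≤c ∷ positive) (c≢L ∷ distinct) (there j∈L) 1≤j =
  trans (flips-inside L j (F c x) positive distinct j∈L 1≤j)
    (cong (1 ∸_) (flip-other c j x 1≤c 1≤j (λ j≡c → All.lookup c≢L j∈L (sym j≡c))))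

module FlipOrder (L : List ℕ) (positive : All (1 ≤_) L) (distinct : AllPairs _≢_ L) where

  flips-agree : ∀ j u v → 1 ≤ j → bit j u ≡ bit j v → bit j (applyFlips L u) ≡ bit j (applyFlips L v)
  flips-agree j u v 1≤j same with j ∈? L
  ... | yes j∈L = trans (flips-inside L j u positive distinct j∈L 1≤j)
                   (trans (cong (1 ∸_) same) (sym (flips-inside L j v positive distinct j∈L 1≤j)))
  ... | no j∉L = trans (flips-outside L j u positive j∉L 1≤j)
                   (trans same (sym (flips-outside L j v positive j∉L 1≤j)))

  flips-agree-above : ∀ {u v p} → 1 ≤ p → AgreeAbove u v p →
                      AgreeAbove (applyFlips L u) (applyFlips L v) p
  flips-agree-above 1≤p agree j p<j = flips-agree j _ _ (≤-trans 1≤p (<⇒≤ p<j)) (agree j p<j)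

  flips-reverse : ∀ {u v p} → u < v → IsM u v p → p ∈ L → applyFlips L v < applyFlips L u
  flips-reverse {u} {v} {suc p} u<v M@(1≤p , _ , agree) p∈L =
    top-digit-order p _ _ v-flipped u-flipped (λ j p<j → sym (flips-agree-above 1≤p agree j p<j))
    where
    u-flipped : bit (suc p) (applyFlips L u) ≡ 1
    u-flipped = trans (flips-inside L (suc p) u positive distinct p∈L 1≤p)
                  (cong (1 ∸_) (proj₁ (order⇒top-digits u<v M)))
    v-flipped : bit (suc p) (applyFlips L v) ≡ 0
    v-flipped = trans (flips-inside L (suc p) v positive distinct p∈L 1≤p)
                  (cong (1 ∸_) (proj₂ (order⇒top-digits u<v M)))

  flips-preserve : ∀ {u v p} → u < v → IsM u v p → p ∉ L → applyFlips L u < applyFlips L v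
  flips-preserve {u} {v} {suc p} u<v M@(1≤p , _ , agree) p∉L =
    top-digit-order p _ _ u-kept v-kept (flips-agree-above 1≤p agree)
    where
    u-kept : bit (suc p) (applyFlips L u) ≡ 0
    u-kept = trans (flips-outside L (suc p) u positive p∉L 1≤p)
               (proj₁ (order⇒top-digits u<v M))
    v-kept : bit (suc p) (applyFlips L v) ≡ 1
    v-kept = trans (flips-outside L (suc p) v positive p∉L 1≤p)
               (proj₂ (order⇒top-digits u<v M))

  flips-bound : ∀ m → All (_≤ m) L → ∀ x → x < 2 ^ m → applyFlips L x < 2 ^ m
  flips-bound m L≤m x x< = high-zero⇒bounded m (applyFlips L x) (λ j m<j →
    trans (flips-outside L j x positive (λ j∈L → <⇒≱ m<j (All.lookup L≤m j∈L)) (≤-trans (s≤s z≤n) m<j))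
          (bounded⇒high-zero m x x< j m<j))

StrictlyMonotone : ∀ {k} → (Fin k → ℕ) → Set
StrictlyMonotone z = ∀ r s → toℕ r < toℕ s → z r < z s

predecessor : ∀ {n} (s : Fin n) t → toℕ s ≡ suc t → Σ (Fin n) λ r → toℕ r ≡ t
predecessor {n} s t e = fromℕ< t<n , toℕ-fromℕ< t<n
  where
  t<n : t < n
  t<n = <-trans (n<1+n t) (subst (_< n) e (toℕ<n s))

increasing-gap : ∀ {n} (z : Fin n → ℕ) → Increasing z →
                 ∀ t (r s : Fin n) → toℕ s ≡ toℕ r + t → z r + t ≤ z s
increasing-gap z inc zero r s e =
  ≤-reflexive (trans (+-identityʳ (z r)) (cong z (toℕ-injective (trans (sym (+-identityʳ (toℕ r))) (sym e)))))
increasing-gap z inc (suc t) r s e with predecessor s (toℕ r + t) (trans e (+-suc (toℕ r) t))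
... | s′ , e′ = subst (_≤ z s) (sym (+-suc (z r) t))
  (≤-<-trans (increasing-gap z inc t r s′ e′) (inc s′ s (trans e (trans (+-suc (toℕ r) t) (cong suc (sym e′))))))

increasing⇒monotone : ∀ {n} (z : Fin n → ℕ) → Increasing z → StrictlyMonotone z
increasing⇒monotone z inc r s r<s = <-≤-trans (m<m+n (z r) (m<n⇒0<n∸m r<s))
  (increasing-gap z inc (toℕ s ∸ toℕ r) r s (sym (m+[n∸m]≡n (<⇒≤ r<s))))

increasing-below-length : ∀ {n} (z : Fin n → ℕ) → Increasing z → (∀ a → z a < n) →
                          ∀ a → z a ≡ toℕ a
increasing-below-length {suc n} z inc z< a = ≤-antisym at-most at-least
  where
  a≤n : toℕ a ≤ n
  a≤n = s≤s⁻¹ (toℕ<n a)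
  at-least : toℕ a ≤ z a
  at-least = ≤-trans (m≤n+m (toℕ a) (z fz)) (increasing-gap z inc (toℕ a) fz a refl)
  to-last : z a + (n ∸ toℕ a) ≤ z (fromℕ n)
  to-last = increasing-gap z inc (n ∸ toℕ a) a (fromℕ n) (trans (toℕ-fromℕ n) (sym (m+[n∸m]≡n a≤n)))
  at-most : z a ≤ toℕ a
  at-most = +-cancelʳ-≤ (n ∸ toℕ a) (z a) (toℕ a)
    (subst (z a + (n ∸ toℕ a) ≤_) (sym (m+[n∸m]≡n a≤n)) (≤-trans to-last (s≤s⁻¹ (z< (fromℕ n)))))

no-increasing-beyond : ∀ n (z : Fin (suc n) → ℕ) → Increasing z → ¬ (∀ a → z a < n)
no-increasing-beyond n z inc z< =
  <⇒≱ (z< (fromℕ n)) (≤-trans (m≤n+m n (z fz)) (increasing-gap z inc n fz (fromℕ n) (toℕ-fromℕ n)))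

-- The compression c(u) = Σ_r b^u_{i_r} 2^r packs the digits of u at the
-- positions i_0, …, i_{h-1} into an h-digit number.
compress : ∀ {h} → (Fin h → ℕ) → ℕ → ℕ
compress {zero} i u = 0
compress {suc h} i u = bit (i fz) u + compress (i ∘ fs) u * 2

compress-tail-digit : ∀ {h} (i : Fin (suc h) → ℕ) u j →
                      bit (suc (suc j)) (compress i u) ≡ bit (suc j) (compress (i ∘ fs) u)
compress-tail-digit i u j = bit-suc-append j (bit (i fz) u) (compress (i ∘ fs) u) (bit<2 (i fz) u)

compress-digit : ∀ {h} (i : Fin h → ℕ) u r → bit (suc (toℕ r)) (compress i u) ≡ bit (i r) u
compress-digit i u fz = bit-one-append (bit (i fz) u) (compress (i ∘ fs) u) (bit<2 (i fz) u)
compress-digit i u (fs r) = trans (compress-tail-digit i u (toℕ r)) (compress-digit (i ∘ fs) u r)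

compress-bound : ∀ {h} (i : Fin h → ℕ) u → compress i u < 2 ^ h
compress-bound {zero} i u = s≤s z≤n
compress-bound {suc h} i u =
  append-bound (bit (i fz) u) (compress (i ∘ fs) u) (2 ^ h) (bit<2 (i fz) u) (compress-bound (i ∘ fs) u)

compress-cong : ∀ {h} (i : Fin h → ℕ) u v → (∀ s → bit (i s) u ≡ bit (i s) v) → compress i u ≡ compress i v
compress-cong {zero} i u v _ = refl
compress-cong {suc h} i u v same =
  cong₂ (λ b q → b + q * 2) (same fz) (compress-cong (i ∘ fs) u v (same ∘ fs))

compress-agree : ∀ {h} (i : Fin h → ℕ) u v (r : Fin h) →
                 (∀ s → toℕ r < toℕ s → bit (i s) u ≡ bit (i s) v) →
                 AgreeAbove (compress i u) (compress i v) (suc (toℕ r))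
compress-agree i u v fz same (suc zero) (s≤s ())
compress-agree i u v fz same (suc (suc j)) _ =
  trans (compress-tail-digit i u j) (trans
    (cong (bit (suc j)) (compress-cong (i ∘ fs) u v (λ s → same (fs s) (s≤s z≤n))))
    (sym (compress-tail-digit i v j)))
compress-agree i u v (fs r) same (suc (suc j)) (s≤s r<j) =
  trans (compress-tail-digit i u j) (trans
    (compress-agree (i ∘ fs) u v r (λ s r<s → same (fs s) (s≤s r<s)) (suc j) r<j)
    (sym (compress-tail-digit i v j)))

compress-IsM : ∀ {h} (i : Fin h → ℕ) → StrictlyMonotone i →
               ∀ {u v} r → IsM u v (i r) → IsM (compress i u) (compress i v) (suc (toℕ r))
compress-IsM i mono {u} {v} r (_ , differ , agree) =
  s≤s z≤n ,
  (λ same → differ (trans (sym (compress-digit i u r)) (trans same (compress-digit i v r)))) ,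
  compress-agree i u v r (λ s r<s → agree (i s) (mono r s r<s))

compress-order : ∀ {h} (i : Fin h → ℕ) → StrictlyMonotone i →
                 ∀ {u v} r → u < v → IsM u v (i r) → compress i u < compress i v
compress-order i mono {u} {v} r u<v M = top-digit-order (toℕ r) _ _
  (trans (compress-digit i u r) (proj₁ (order⇒top-digits u<v M)))
  (trans (compress-digit i v r) (proj₂ (order⇒top-digits u<v M)))
  (proj₂ (proj₂ (compress-IsM i mono r M)))

module Profile (m h : ℕ) (i : Fin h → ℕ) (bounds : ∀ r → 1 ≤ i r × i r ≤ m)
               (mono : StrictlyMonotone i) where

  f : ℕ → ℕ
  f = fIdx (2 ^ m) h i

  positive : All (1 ≤_) (tabulate i)
  positive = tabulate⁺ (proj₁ ∘ bounds)

  distinct : AllPairs _≢_ (tabulate i)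
  distinct = AllPairs.map <⇒≢ (tabulate⁺-< (λ {r} {s} → mono r s))

  open FlipOrder (tabulate i) positive distinct

  f-step⇒listed : ∀ u v → u < v → u < 2 ^ m → v < 2 ^ m → f u < f v → Σ (Fin h) λ r → IsM u v (i r)
  f-step⇒listed u v u<v u< v< fu<fv with IsM-exists m u v u< v< (<⇒≢ u<v)
  ... | p , M with p ∈? tabulate i
  ...   | yes p∈L = let (r , p≡ir) = ∈-tabulate⁻ p∈L in r , subst (IsM u v) p≡ir M
  ...   | no p∉L = ⊥-elim (<⇒≱ fu<fv (∸-monoʳ-≤ (2 ^ m + 1) (<⇒≤ (flips-preserve u<v M p∉L))))

  listed⇒f-step : ∀ u v r → u < v → u < 2 ^ m → IsM u v (i r) → f u < f v
  listed⇒f-step u v r u<v u< M = ∸-monoʳ-< (flips-reverse u<v M (∈-tabulate⁺ r))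
    (≤-trans (<⇒≤ (flips-bound m (tabulate⁺ (proj₂ ∘ bounds)) u u<)) (m≤m+n (2 ^ m) 1))

  compress-increasing : ∀ {k} (y : Fin k → ℕ) → (∀ a → y a < 2 ^ m) → Increasing y →
                        Increasing (f ∘ y) → Increasing (compress i ∘ y)
  compress-increasing y y< y-inc f-inc a b e =
    let (r , M) = f-step⇒listed (y a) (y b) (y-inc a b e) (y< a) (y< b) (f-inc a b e)
    in compress-order i mono r (y-inc a b e) M

lemma4p10 : (m h : ℕ) → 2 ≤ 2 ^ h → 2 ^ h ≤ 2 ^ m →
    (i : Fin h → ℕ) →
    (∀ r → 1 ≤ i r × i r ≤ m) →
    (∀ (r s : Fin h) → toℕ s ≡ suc (toℕ r) → i r < i s) →
    ((x : Fin (2 ^ h) → ℕ) → (∀ a → x a < 2 ^ m) → Increasing x →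
       (Increasing (λ a → fIdx (2 ^ m) h i (x a)) ⇔ HasProfile i x))
    × ¬ (Σ (Fin (suc (2 ^ h)) → ℕ) λ y → (∀ a → y a < 2 ^ m) × Increasing y
           × Increasing (λ a → fIdx (2 ^ m) h i (y a)))
lemma4p10 m h _ _ i bounds i-inc = profile , no-long
  where
  open Profile m h i bounds (increasing⇒monotone i i-inc)
  profile : (x : Fin (2 ^ h) → ℕ) → (∀ a → x a < 2 ^ m) → Increasing x →
            Increasing (f ∘ x) ⇔ HasProfile i x
  profile x x< x-inc = mk⇔ to from
    where
    to : Increasing (f ∘ x) → HasProfile i x
    to f-inc a b e =
      let (r , M) = f-step⇒listed (x a) (x b) (x-inc a b e) (x< a) (x< b) (f-inc a b e)
      in r , subst₂ (λ p q → IsM p q (suc (toℕ r))) (compressed-index a) (compressed-index b)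
                    (compress-IsM i (increasing⇒monotone i i-inc) r M) , M
      where
      -- c ∘ x enumerates 0, …, 2^h - 1, so c(x_a) = a
      compressed-index : ∀ a → compress i (x a) ≡ toℕ a
      compressed-index = increasing-below-length (compress i ∘ x)
        (compress-increasing x x< x-inc f-inc) (compress-bound i ∘ x)
    from : HasProfile i x → Increasing (f ∘ x)
    from has-profile a b e =
      let (r , _ , M) = has-profile a b e in listed⇒f-step (x a) (x b) r (x-inc a b e) (x< a) M
  no-long : ¬ (Σ (Fin (suc (2 ^ h)) → ℕ) λ y → (∀ a → y a < 2 ^ m) × Increasing y × Increasing (f ∘ y))
  no-long (y , y< , y-inc , f-inc) =
    no-increasing-beyond (2 ^ h) (compress i ∘ y) (compress-increasing y y< y-inc f-inc) (compress-bound i ∘ y)
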